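{- Let $d$ be a multiple of $3$ and let $n\ge d+3$. Then the largest possible number of maximal cliques in an $n$-vertex graph with degeneracy $d$ is $(n-d)3^{d/3}$; that is, every $n$-vertex graph with degeneracy $d$ has at most $(n-d)3^{d/3}$ maximal cliques, and some $n$-vertex graph with degeneracy $d$ has exactly $(n-d)3^{d/3}$ maximal cliques.
   Context: The degeneracy of a graph $G$ is the smallest value $d$ such that every nonempty subgraph of $G$ contains a vertex of degree at most $d$. A maximal clique is a clique not contained in any larger clique. -}

module Defs where

open import Data.Bool using (Bool; true; false)
open import Data.Nat using (ℕ; zero; suc; _≤_)
open import Data.Fin using (Fin)
open import Data.Fin.Subset using (Subset; _∈_; _⊆_; _⊂_; _∩_; ∣_∣; Nonempty; inside; outside)
open import Data.Fin.Subset.Properties using (_∈?_; _⊂?_; anySubset?)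
open import Data.Fin.Properties using (all?; _≟_)
open import Data.Vec using (tabulate; _∷_; [])
open import Data.List using (List; length; filter; map; _++_) renaming ([] to []ₗ; _∷_ to _∷ₗ_)
open import Data.Product using (Σ; ∃; ∃-syntax; _×_; _,_)
open import Relation.Binary.PropositionalEquality using (_≡_; _≢_)
open import Relation.Nullary using (Dec; yes; no; ¬_)
open import Relation.Nullary.Decidable using (¬?; _→-dec_; _×-dec_)
open import Data.Bool.Properties using () renaming (_≟_ to _≟ᵇ_)

record Graph (n : ℕ) : Set where
  field
    adj    : Fin n → Fin n → Bool
    sym    : ∀ u v → adj u v ≡ adj v u
    irrefl : ∀ v → adj v v ≡ false
open Graph public

N : ∀ {n} → Graph n → Fin n → Subset n
N G v = tabulate (adj G v)

degIn : ∀ {n} → Graph n → Subset n → Fin n → ℕ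
degIn G S v = ∣ S ∩ N G v ∣

Degenerate : ∀ {n} → Graph n → ℕ → Set
Degenerate G d = ∀ S → Nonempty S → ∃[ v ] (v ∈ S × degIn G S v ≤ d)

HasDegeneracy : ∀ {n} → Graph n → ℕ → Set
HasDegeneracy G d = Degenerate G d × (∀ k → Degenerate G k → d ≤ k)

IsClique : ∀ {n} → Graph n → Subset n → Set
IsClique G S = ∀ u v → u ∈ S → v ∈ S → u ≢ v → adj G u v ≡ true

IsMaximalClique : ∀ {n} → Graph n → Subset n → Set
IsMaximalClique G S = IsClique G S × ¬ (∃[ T ] (IsClique G T × S ⊂ T))

isClique? : ∀ {n} (G : Graph n) (S : Subset n) → Dec (IsClique G S)
isClique? G S with all? (λ u → all? (λ v → (u ∈? S) →-dec ((v ∈? S) →-dec (¬? (u ≟ v) →-dec (adj G u v ≟ᵇ true)))))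
... | yes p = yes (λ u v → p u v)
... | no ¬p = no (λ c → ¬p (λ u v → c u v))

isMaximalClique? : ∀ {n} (G : Graph n) (S : Subset n) → Dec (IsMaximalClique G S)
isMaximalClique? G S = isClique? G S ×-dec ¬? (anySubset? (λ T → isClique? G T ×-dec (S ⊂? T)))

allSubsets : ∀ n → List (Subset n)
allSubsets zero = [] ∷ₗ []ₗ
allSubsets (suc n) = map (inside ∷_) (allSubsets n) ++ map (outside ∷_) (allSubsets n)

numMaximalCliques : ∀ {n} → Graph n → ℕ
numMaximalCliques {n} G = length (filter (isMaximalClique? G) (allSubsets n))

module Submission where

-- All counting is done for induced subgraphs G[S], S ⊆ Fin n, by summing the indicator of
-- "C is a maximal clique of G[S]" over all subsets C.  Two counting principles drive the
-- argument: the maximal cliques of G[S] through u ∈ S correspond, by toggling u, to the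
-- maximal cliques of G[S ∩ N(u)]; and a set T meeting every maximal clique bounds their
-- number by the sum over u ∈ T of those through u (with equality if T is independent).
--
-- Upper bound: branching on the non-neighbours of a vertex of maximum degree gives the
-- Moon–Moser bound h(|S|) for G[S]; deleting vertices of degree ≤ d one at a time then gives
-- (n - d)·h(d) for d-degenerate G, and h(3q) = 3^q.  Lower bound: the complete multipartite
-- graph with q parts of size 3 and one part of size n - d has degeneracy d and (n - d)·3^q
-- maximal cliques (one vertex from each part), counted by peeling off one part at a time.

open import Data.Nat using (ℕ; _+_; _*_; _∸_; _^_; _≤_; _/_)
open import Data.Nat.Divisibility using (_∣_)
open import Data.Product using (∃-syntax; Σ-syntax; _×_)
open import Relation.Binary.PropositionalEquality using (_≡_)
open import Defs renaming (sym to adj-sym)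

open import Data.Bool using (true; false; not; if_then_else_)
open import Data.Bool.Properties using (not-¬; ¬-not) renaming (_≟_ to _≟ᵇ_)
open import Data.Empty using (⊥-elim)
open import Data.Fin using (Fin; zero; suc; toℕ; fromℕ<)
open import Data.Fin.Properties using (all?; any?) renaming (suc-injective to fsuc-injective; _≟_ to _≟ᶠ_)
open import Data.Fin.Subset
  using (Subset; inside; outside; _∈_; _∉_; _⊆_; _⊂_; _∩_; _-_; ∁; ⊤; ⊥; ⁅_⁆; ∣_∣; Nonempty; Empty)
open import Data.Fin.Subset.Properties
  using ( _∈?_; _⊆?_; nonempty?; ∈⊤; ∉⊥; ⊥⊆; Empty-unique; ⊆-antisym; x∈∁p⇒x∉p; x∉p⇒x∈∁p
        ; x∈p∩q⁺; x∈p∩q⁻; x∈p∧x≢y⇒x∈p-y; p─q⊆p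
        ; ∣⊥∣≡0; ∣⊤∣≡n; ∣∁p∣≡n∸∣p∣; p⊆q⇒∣p∣≤∣q∣; x∈p⇒∣p-x∣<∣p∣ )
open import Data.List using (List; length; filter; map; _++_)
open import Data.List.Properties using (length-++; filter-++)
open import Data.Nat using (zero; suc; _<_; z≤n; s≤s)
open import Data.Nat.Divisibility using (divides)
open import Data.Nat.DivMod using (m≡m%n+[m/n]*n; m%n<n; m/n*n≤m; m<n*o⇒m/o<n; /-monoˡ-≤; m*n/n≡m)
open import Data.Nat.Properties
open import Algebra.Properties.CommutativeSemigroup +-commutativeSemigroup using (interchange)
open import Algebra.Properties.CommutativeSemigroup *-commutativeSemigroup using (x∙yz≈y∙xz)
open import Data.Product using (_,_; proj₁; proj₂)
open import Data.Sum using (_⊎_; inj₁; inj₂)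
open import Data.Vec using ([]; _∷_; here; there; tabulate)
open import Data.Vec.Properties using (≡-dec; lookup∘tabulate; lookup⇒[]=; []=⇒lookup)
open import Function using (_∘_)
open import Relation.Binary.PropositionalEquality
  using (refl; sym; trans; cong; cong₂; subst; _≢_; module ≡-Reasoning)
open import Relation.Nullary using (Dec; yes; no; ¬_; does)
open import Relation.Nullary.Decidable using (¬?; _×-dec_; _→-dec_; True; toWitness; dec-true; dec-false)

𝟙 : ∀ {p} {P : Set p} → Dec P → ℕ
𝟙 d = if does d then 1 else 0

does-cong : ∀ {p q} {P : Set p} {Q : Set q} (P? : Dec P) (Q? : Dec Q) → (P → Q) → (Q → P) → does P? ≡ does Q?
does-cong (yes _) (yes _) _   _   = refl
does-cong (no _)  (no _)  _   _   = refl
does-cong (yes p) (no ¬q) P→Q _   = ⊥-elim (¬q (P→Q p))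
does-cong (no ¬p) (yes q) _   Q→P = ⊥-elim (¬p (Q→P q))

𝟙-mono : ∀ {p q} {P : Set p} {Q : Set q} (P? : Dec P) (Q? : Dec Q) → (P → Q) → 𝟙 P? ≤ 𝟙 Q?
𝟙-mono (yes _) (yes _) _   = ≤-refl
𝟙-mono (yes p) (no ¬q) P→Q = ⊥-elim (¬q (P→Q p))
𝟙-mono (no _)  _       _   = z≤n

𝟙-cong : ∀ {p q} {P : Set p} {Q : Set q} (P? : Dec P) (Q? : Dec Q) → (P → Q) → (Q → P) → 𝟙 P? ≡ 𝟙 Q?
𝟙-cong P? Q? P→Q Q→P = cong (λ b → if b then 1 else 0) (does-cong P? Q? P→Q Q→P)

𝟙-yes : ∀ {p} {P : Set p} (P? : Dec P) → P → 𝟙 P? ≡ 1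
𝟙-yes (yes _) _ = refl
𝟙-yes (no ¬p) p = ⊥-elim (¬p p)

𝟙-no : ∀ {p} {P : Set p} (P? : Dec P) → ¬ P → 𝟙 P? ≡ 0
𝟙-no (yes p) ¬p = ⊥-elim (¬p p)
𝟙-no (no _)  _  = refl

sumSubsets : ∀ n → (Subset n → ℕ) → ℕ
sumSubsets zero    f = f []
sumSubsets (suc n) f = sumSubsets n (f ∘ (inside ∷_)) + sumSubsets n (f ∘ (outside ∷_))

sumSubsets-cong : ∀ n {f g : Subset n → ℕ} → (∀ C → f C ≡ g C) → sumSubsets n f ≡ sumSubsets n g
sumSubsets-cong zero    f≡g = f≡g []
sumSubsets-cong (suc n) f≡g =
  cong₂ _+_ (sumSubsets-cong n (f≡g ∘ (inside ∷_))) (sumSubsets-cong n (f≡g ∘ (outside ∷_)))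

sumSubsets-mono : ∀ n {f g : Subset n → ℕ} → (∀ C → f C ≤ g C) → sumSubsets n f ≤ sumSubsets n g
sumSubsets-mono zero    f≤g = f≤g []
sumSubsets-mono (suc n) f≤g =
  +-mono-≤ (sumSubsets-mono n (f≤g ∘ (inside ∷_))) (sumSubsets-mono n (f≤g ∘ (outside ∷_)))

sumSubsets-0 : ∀ n → sumSubsets n (λ _ → 0) ≡ 0
sumSubsets-0 zero    = refl
sumSubsets-0 (suc n) = cong₂ _+_ (sumSubsets-0 n) (sumSubsets-0 n)

sumSubsets-+ : ∀ n (f g : Subset n → ℕ) →
               sumSubsets n (λ C → f C + g C) ≡ sumSubsets n f + sumSubsets n g
sumSubsets-+ zero    f g = refl
sumSubsets-+ (suc n) f g =
  trans (cong₂ _+_ (sumSubsets-+ n _ _) (sumSubsets-+ n _ _))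
        (interchange (sumSubsets n (f ∘ (inside ∷_))) (sumSubsets n (g ∘ (inside ∷_)))
                     (sumSubsets n (f ∘ (outside ∷_))) (sumSubsets n (g ∘ (outside ∷_))))

length-filter-map : ∀ {A B : Set} {P : B → Set} (P? : ∀ b → Dec (P b)) (f : A → B) (xs : List A) →
                    length (filter P? (map f xs)) ≡ length (filter (P? ∘ f) xs)
length-filter-map P? f List.[] = refl
length-filter-map P? f (x List.∷ xs) with does (P? (f x))
... | true  = cong suc (length-filter-map P? f xs)
... | false = length-filter-map P? f xs

count≡sumSubsets : ∀ n {P : Subset n → Set} (P? : ∀ C → Dec (P C)) →
                   length (filter P? (allSubsets n)) ≡ sumSubsets n (𝟙 ∘ P?)
count≡sumSubsets zero    P? with does (P? [])
... | true  = refl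
... | false = refl
count≡sumSubsets (suc n) P? = begin
  length (filter P? (map (inside ∷_) (allSubsets n) ++ map (outside ∷_) (allSubsets n)))
    ≡⟨ cong length (filter-++ P? (map (inside ∷_) (allSubsets n)) _) ⟩
  length (filter P? (map (inside ∷_) (allSubsets n)) ++ filter P? (map (outside ∷_) (allSubsets n)))
    ≡⟨ length-++ (filter P? (map (inside ∷_) (allSubsets n))) ⟩
  length (filter P? (map (inside ∷_) (allSubsets n))) + length (filter P? (map (outside ∷_) (allSubsets n)))
    ≡⟨ cong₂ _+_ (length-filter-map P? (inside ∷_) (allSubsets n)) (length-filter-map P? (outside ∷_) (allSubsets n)) ⟩
  length (filter (P? ∘ (inside ∷_)) (allSubsets n)) + length (filter (P? ∘ (outside ∷_)) (allSubsets n))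
    ≡⟨ cong₂ _+_ (count≡sumSubsets n (P? ∘ (inside ∷_))) (count≡sumSubsets n (P? ∘ (outside ∷_))) ⟩
  sumSubsets (suc n) (𝟙 ∘ P?) ∎
  where open ≡-Reasoning

sumSubsets-≡⊥ : ∀ n → sumSubsets n (λ C → 𝟙 (≡-dec _≟ᵇ_ C ⊥)) ≡ 1
sumSubsets-≡⊥ zero    = refl
sumSubsets-≡⊥ (suc n) = cong₂ _+_ (sumSubsets-0 n) (sumSubsets-≡⊥ n)

-- Toggling the membership of one vertex is an involution on subsets,
-- so sums over all subsets are invariant under it.
toggle : ∀ {n} → Fin n → Subset n → Subset n
toggle zero    (s ∷ C) = not s ∷ C
toggle (suc u) (s ∷ C) = s ∷ toggle u C

sumSubsets-toggle : ∀ n (u : Fin n) (f : Subset n → ℕ) →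
                    sumSubsets n (f ∘ toggle u) ≡ sumSubsets n f
sumSubsets-toggle (suc n) zero    f = +-comm (sumSubsets n (f ∘ (outside ∷_))) _
sumSubsets-toggle (suc n) (suc u) f =
  cong₂ _+_ (sumSubsets-toggle n u (f ∘ (inside ∷_))) (sumSubsets-toggle n u (f ∘ (outside ∷_)))

toggle-∉ : ∀ {n} {u : Fin n} {C} → u ∉ C → u ∈ toggle u C
toggle-∉ {u = zero}  {inside  ∷ C} u∉C = ⊥-elim (u∉C here)
toggle-∉ {u = zero}  {outside ∷ C} u∉C = here
toggle-∉ {u = suc u} {s ∷ C}       u∉C = there (toggle-∉ (u∉C ∘ there))

toggle-∈ : ∀ {n} {u : Fin n} {C} → u ∈ toggle u C → u ∉ C
toggle-∈ {u = zero}  {inside ∷ C} () here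
toggle-∈ {u = suc u} {s ∷ C}      (there u∈) (there u∈C) = toggle-∈ u∈ u∈C

toggle-≢⁺ : ∀ {n} {u x : Fin n} {C} → x ≢ u → x ∈ C → x ∈ toggle u C
toggle-≢⁺ {u = zero}  {zero}  x≢u _           = ⊥-elim (x≢u refl)
toggle-≢⁺ {u = zero}  {suc x} _   (there x∈C) = there x∈C
toggle-≢⁺ {u = suc u} {zero}  _   here        = here
toggle-≢⁺ {u = suc u} {suc x} x≢u (there x∈C) = there (toggle-≢⁺ (x≢u ∘ cong suc) x∈C)

toggle-≢⁻ : ∀ {n} {u x : Fin n} {C} → x ≢ u → x ∈ toggle u C → x ∈ C
toggle-≢⁻ {u = zero}  {zero}  x≢u _          = ⊥-elim (x≢u refl)
toggle-≢⁻ {u = zero}  {suc x} {_ ∷ C} _   (there x∈) = there x∈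
toggle-≢⁻ {u = suc u} {zero}  {_ ∷ C} _   here       = here
toggle-≢⁻ {u = suc u} {suc x} {_ ∷ C} x≢u (there x∈) = there (toggle-≢⁻ (x≢u ∘ cong suc) x∈)

toggle-members : ∀ {n} {u x : Fin n} {C} → x ∈ toggle u C → x ≡ u ⊎ x ∈ C
toggle-members {u = u} {x} x∈ with x ≟ᶠ u
... | yes x≡u = inj₁ x≡u
... | no  x≢u = inj₂ (toggle-≢⁻ x≢u x∈)

sumOver : ∀ {n} → Subset n → (Fin n → ℕ) → ℕ
sumOver []            f = 0
sumOver (inside  ∷ T) f = f zero + sumOver T (f ∘ suc)
sumOver (outside ∷ T) f = sumOver T (f ∘ suc)

sumOver-cong : ∀ {n} (T : Subset n) {f g : Fin n → ℕ} → (∀ {u} → u ∈ T → f u ≡ g u) →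
               sumOver T f ≡ sumOver T g
sumOver-cong []            f≡g = refl
sumOver-cong (inside  ∷ T) f≡g = cong₂ _+_ (f≡g here) (sumOver-cong T (f≡g ∘ there))
sumOver-cong (outside ∷ T) f≡g = sumOver-cong T (f≡g ∘ there)

sumOver-mono : ∀ {n} (T : Subset n) {f g : Fin n → ℕ} → (∀ {u} → u ∈ T → f u ≤ g u) →
               sumOver T f ≤ sumOver T g
sumOver-mono []            f≤g = z≤n
sumOver-mono (inside  ∷ T) f≤g = +-mono-≤ (f≤g here) (sumOver-mono T (f≤g ∘ there))
sumOver-mono (outside ∷ T) f≤g = sumOver-mono T (f≤g ∘ there)

sumOver-const : ∀ {n} (T : Subset n) c → sumOver T (λ _ → c) ≡ ∣ T ∣ * c
sumOver-const []            c = refl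
sumOver-const (inside  ∷ T) c = cong (c +_) (sumOver-const T c)
sumOver-const (outside ∷ T) c = sumOver-const T c

term≤sumOver : ∀ {n} {T : Subset n} {u} (f : Fin n → ℕ) → u ∈ T → f u ≤ sumOver T f
term≤sumOver {T = inside  ∷ T} f here      = m≤m+n (f zero) _
term≤sumOver {T = inside  ∷ T} f (there u∈T) = ≤-trans (term≤sumOver (f ∘ suc) u∈T) (m≤n+m _ (f zero))
term≤sumOver {T = outside ∷ T} f (there u∈T) = term≤sumOver (f ∘ suc) u∈T

sumOver-0 : ∀ {n} (T : Subset n) {f : Fin n → ℕ} → (∀ {u} → u ∈ T → f u ≡ 0) → sumOver T f ≡ 0
sumOver-0 T f≡0 = trans (sumOver-cong T f≡0) (trans (sumOver-const T 0) (*-zeroʳ ∣ T ∣))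

sumOver-single : ∀ {n} {T : Subset n} {u} (f : Fin n → ℕ) → u ∈ T →
                 (∀ {v} → v ∈ T → v ≢ u → f v ≡ 0) → sumOver T f ≡ f u
sumOver-single {T = inside ∷ T} f here others =
  trans (cong (f zero +_) (sumOver-0 T (λ v∈T → others (there v∈T) λ ()))) (+-identityʳ (f zero))
sumOver-single {T = inside ∷ T} f (there u∈T) others =
  cong₂ _+_ (others here λ ()) (sumOver-single (f ∘ suc) u∈T λ v∈T v≢u → others (there v∈T) (v≢u ∘ fsuc-injective))
sumOver-single {T = outside ∷ T} f (there u∈T) others =
  sumOver-single (f ∘ suc) u∈T λ v∈T v≢u → others (there v∈T) (v≢u ∘ fsuc-injective)

sumSubsets-sumOver : ∀ n {m} (T : Subset m) (f : Fin m → Subset n → ℕ) →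
                     sumSubsets n (λ C → sumOver T (λ u → f u C)) ≡ sumOver T (λ u → sumSubsets n (f u))
sumSubsets-sumOver n []            f = sumSubsets-0 n
sumSubsets-sumOver n (inside  ∷ T) f =
  trans (sumSubsets-+ n (f zero) _) (cong (sumSubsets n (f zero) +_) (sumSubsets-sumOver n T (f ∘ suc)))
sumSubsets-sumOver n (outside ∷ T) f = sumSubsets-sumOver n T (f ∘ suc)

∣S∣≡∣S∩A∣+∣S∩∁A∣ : ∀ {n} (S A : Subset n) → ∣ S ∣ ≡ ∣ S ∩ A ∣ + ∣ S ∩ ∁ A ∣
∣S∣≡∣S∩A∣+∣S∩∁A∣ []            []            = refl
∣S∣≡∣S∩A∣+∣S∩∁A∣ (inside  ∷ S) (inside  ∷ A) = cong suc (∣S∣≡∣S∩A∣+∣S∩∁A∣ S A)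
∣S∣≡∣S∩A∣+∣S∩∁A∣ (inside  ∷ S) (outside ∷ A) = trans (cong suc (∣S∣≡∣S∩A∣+∣S∩∁A∣ S A)) (sym (+-suc _ _))
∣S∣≡∣S∩A∣+∣S∩∁A∣ (outside ∷ S) (inside  ∷ A) = ∣S∣≡∣S∩A∣+∣S∩∁A∣ S A
∣S∣≡∣S∩A∣+∣S∩∁A∣ (outside ∷ S) (outside ∷ A) = ∣S∣≡∣S∩A∣+∣S∩∁A∣ S A

∈⇒∣S∣>0 : ∀ {n} {S : Subset n} {x} → x ∈ S → 0 < ∣ S ∣
∈⇒∣S∣>0 x∈S = ≤-trans (s≤s z≤n) (x∈p⇒∣p-x∣<∣p∣ x∈S)

∣S∣>0⇒nonempty : ∀ {n} (S : Subset n) → 0 < ∣ S ∣ → Nonempty S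
∣S∣>0⇒nonempty {n} S ∣S∣>0 with nonempty? S
... | yes S-nonempty = S-nonempty
... | no  S-empty    = ⊥-elim (<⇒≢ ∣S∣>0 (sym (trans (cong ∣_∣ (Empty-unique S-empty)) (∣⊥∣≡0 n))))

argmax : ∀ {n} (S : Subset n) → Nonempty S → (f : Fin n → ℕ) →
         ∃[ v ] (v ∈ S × (∀ {u} → u ∈ S → f u ≤ f v))
argmax (outside ∷ S) (suc x , there x∈S) f with argmax S (x , x∈S) (f ∘ suc)
... | v , v∈S , v-max = suc v , there v∈S , λ { (there u∈S) → v-max u∈S }
argmax (inside ∷ S) _ f with nonempty? S
... | no  S-empty    = zero , here , λ { here → ≤-refl ; (there u∈S) → ⊥-elim (S-empty (_ , u∈S)) }
... | yes S-nonempty with argmax S S-nonempty (f ∘ suc)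
...   | v , v∈S , v-max with f (suc v) ≤? f zero
...     | yes fv≤f0 = zero , here , λ { here → ≤-refl ; (there u∈S) → ≤-trans (v-max u∈S) fv≤f0 }
...     | no  fv≰f0 = suc v , there v∈S , λ { here → <⇒≤ (≰⇒> fv≰f0) ; (there u∈S) → v-max u∈S }

subset : ∀ {n} {P : Fin n → Set} → (∀ x → Dec (P x)) → Subset n
subset P? = tabulate (does ∘ P?)

∈subset⁺ : ∀ {n} {P : Fin n → Set} (P? : ∀ x → Dec (P x)) {x} → P x → x ∈ subset P?
∈subset⁺ P? {x} Px = lookup⇒[]= x (subset P?) (trans (lookup∘tabulate (does ∘ P?) x) (dec-true (P? x) Px))

∈subset⁻ : ∀ {n} {P : Fin n → Set} (P? : ∀ x → Dec (P x)) {x} → x ∈ subset P? → P x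
∈subset⁻ P? {x} x∈ with P? x | trans (sym (lookup∘tabulate (does ∘ P?) x)) ([]=⇒lookup x∈)
... | yes Px | _ = Px

initial : ∀ {n} → ℕ → Subset n
initial b = subset λ x → toℕ x <? b

∣initial∣ : ∀ {n} b → b ≤ n → ∣ initial {n} b ∣ ≡ b
∣initial∣ {n}     zero    _         =
  trans (cong ∣_∣ (Empty-unique {n} {initial 0} λ (_ , x∈) → n≮0 (∈subset⁻ (λ x → toℕ x <? 0) x∈))) (∣⊥∣≡0 n)
∣initial∣ {suc n} (suc b) (s≤s b≤n) = cong suc (∣initial∣ b b≤n)

segment : ∀ {n} → ℕ → ℕ → Subset n
segment a b = initial b ∩ ∁ (initial a)

∣segment∣ : ∀ {n} a b → a ≤ b → b ≤ n → ∣ segment {n} a b ∣ ≡ b ∸ a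
∣segment∣ {n} a b a≤b b≤n = sym (begin
  b ∸ a                   ≡⟨ cong (_∸ a) (∣initial∣ b b≤n) ⟨
  ∣ I b ∣ ∸ a             ≡⟨ cong (_∸ a) (∣S∣≡∣S∩A∣+∣S∩∁A∣ (I b) (I a)) ⟩
  ∣ I b ∩ I a ∣ + σ ∸ a   ≡⟨ cong (λ A → ∣ A ∣ + σ ∸ a) Ib∩Ia≡Ia ⟩
  ∣ I a ∣ + σ ∸ a         ≡⟨ cong (λ z → z + σ ∸ a) (∣initial∣ a (≤-trans a≤b b≤n)) ⟩
  a + σ ∸ a               ≡⟨ m+n∸m≡n a σ ⟩
  σ                       ∎)
  where
  open ≡-Reasoning
  I : ℕ → Subset n
  I = initial
  σ : ℕ
  σ = ∣ segment {n} a b ∣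
  Ib∩Ia≡Ia : I b ∩ I a ≡ I a
  Ib∩Ia≡Ia = ⊆-antisym (λ x∈ → proj₂ (x∈p∩q⁻ (I b) (I a) x∈))
    λ x∈ → x∈p∩q⁺ (∈subset⁺ (λ x → toℕ x <? b) (<-≤-trans (∈subset⁻ (λ x → toℕ x <? a) x∈) a≤b) , x∈)

-- Counting maximal cliques of the induced subgraphs G[S] of a fixed graph G.
module MaximalCliques {n : ℕ} (G : Graph n) where

  ∈N⁺ : ∀ {u x} → adj G u x ≡ true → x ∈ N G u
  ∈N⁺ {u} {x} ux = lookup⇒[]= x (N G u) (trans (lookup∘tabulate (adj G u) x) ux)

  ∈N⁻ : ∀ {u x} → x ∈ N G u → adj G u x ≡ true
  ∈N⁻ {u} {x} x∈N = trans (sym (lookup∘tabulate (adj G u) x)) ([]=⇒lookup x∈N)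

  adj⇒≢ : ∀ {u v} → adj G u v ≡ true → u ≢ v
  adj⇒≢ {u} uv refl = not-¬ uv (irrefl G u)

  -- C is a maximal clique of G[S]: a clique inside S such that every other
  -- vertex of S has a non-neighbour in C.
  MaxCliqueIn : Subset n → Subset n → Set
  MaxCliqueIn S C = C ⊆ S × IsClique G C
                  × (∀ w → w ∈ S → w ∉ C → ∃[ x ] (x ∈ C × adj G w x ≡ false))

  maxCliqueIn? : ∀ S C → Dec (MaxCliqueIn S C)
  maxCliqueIn? S C = (C ⊆? S) ×-dec isClique? G C
    ×-dec all? (λ w → (w ∈? S) →-dec (¬? (w ∈? C) →-dec any? (λ x → (x ∈? C) ×-dec (adj G w x ≟ᵇ false))))

  #maxCliques : Subset n → ℕ
  #maxCliques S = sumSubsets n (𝟙 ∘ maxCliqueIn? S)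

  #maxCliquesThrough : Subset n → Fin n → ℕ
  #maxCliquesThrough S u = sumSubsets n (λ C → 𝟙 (maxCliqueIn? S C ×-dec (u ∈? C)))

  toggle-clique : ∀ {C w} → IsClique G C → w ∉ C → (∀ {x} → x ∈ C → adj G w x ≡ true) →
                  IsClique G (toggle w C)
  toggle-clique {C} {w} C-clique w∉C w-adj a b a∈ b∈ a≢b
    with toggle-members {C = C} a∈ | toggle-members {C = C} b∈
  ... | inj₁ refl | inj₁ refl = ⊥-elim (a≢b refl)
  ... | inj₁ refl | inj₂ b∈C  = w-adj b∈C
  ... | inj₂ a∈C  | inj₁ refl = trans (adj-sym G a w) (w-adj a∈C)
  ... | inj₂ a∈C  | inj₂ b∈C  = C-clique a b a∈C b∈C a≢b

  maximal⇒maxCliqueIn⊤ : ∀ {C} → IsMaximalClique G C → MaxCliqueIn ⊤ C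
  maximal⇒maxCliqueIn⊤ {C} (C-clique , C-maximal) = (λ _ → ∈⊤) , C-clique , blocked
    where
    blocked : ∀ w → w ∈ ⊤ → w ∉ C → ∃[ x ] (x ∈ C × adj G w x ≡ false)
    blocked w _ w∉C with any? (λ x → (x ∈? C) ×-dec (adj G w x ≟ᵇ false))
    ... | yes witness = witness
    ... | no  none    = ⊥-elim (C-maximal (toggle w C , bigger-clique , C⊆ , w , toggle-∉ w∉C , w∉C))
      where
      bigger-clique : IsClique G (toggle w C)
      bigger-clique = toggle-clique C-clique w∉C λ {x} x∈C → ¬-not λ wx → none (x , x∈C , wx)
      C⊆ : C ⊆ toggle w C
      C⊆ x∈C = toggle-≢⁺ (λ { refl → w∉C x∈C }) x∈C

  maxCliqueIn⊤⇒maximal : ∀ {C} → MaxCliqueIn ⊤ C → IsMaximalClique G C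
  maxCliqueIn⊤⇒maximal {C} (_ , C-clique , blocked) = C-clique , not-extendable
    where
    not-extendable : ¬ (∃[ T ] (IsClique G T × C ⊂ T))
    not-extendable (T , T-clique , C⊆T , w , w∈T , w∉C) with blocked w ∈⊤ w∉C
    ... | x , x∈C , wx = not-¬ (T-clique w x w∈T (C⊆T x∈C) (λ { refl → w∉C x∈C })) wx

  numMaximalCliques≡#maxCliques⊤ : numMaximalCliques G ≡ #maxCliques ⊤
  numMaximalCliques≡#maxCliques⊤ =
    trans (count≡sumSubsets n (isMaximalClique? G))
          (sumSubsets-cong n λ C → 𝟙-cong (isMaximalClique? G C) (maxCliqueIn? ⊤ C)
                                          maximal⇒maxCliqueIn⊤ maxCliqueIn⊤⇒maximal)

  -- Removing u from the maximal cliques of G[S] through u gives exactly the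
  -- maximal cliques of G[S ∩ N(u)]; toggling u is the bijection.
  through⇒ : ∀ {S u C} → MaxCliqueIn S (toggle u C) → u ∈ toggle u C → MaxCliqueIn (S ∩ N G u) C
  through⇒ {S} {u} {C} (D⊆S , D-clique , D-blocked) u∈D = C⊆S∩Nu , C-clique , C-blocked
    where
    u∉C : u ∉ C
    u∉C = toggle-∈ u∈D
    C⊆D : C ⊆ toggle u C
    C⊆D x∈C = toggle-≢⁺ (λ { refl → u∉C x∈C }) x∈C
    C⊆S∩Nu : C ⊆ S ∩ N G u
    C⊆S∩Nu {x} x∈C = x∈p∩q⁺ (D⊆S (C⊆D x∈C) , ∈N⁺ (D-clique u x u∈D (C⊆D x∈C) λ { refl → u∉C x∈C }))
    C-clique : IsClique G C
    C-clique a b a∈C b∈C = D-clique a b (C⊆D a∈C) (C⊆D b∈C)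
    C-blocked : ∀ w → w ∈ S ∩ N G u → w ∉ C → ∃[ x ] (x ∈ C × adj G w x ≡ false)
    C-blocked w w∈ w∉C with x∈p∩q⁻ S (N G u) w∈
    ... | w∈S , w∈Nu with D-blocked w w∈S (w∉C ∘ toggle-≢⁻ (adj⇒≢ (∈N⁻ w∈Nu) ∘ sym))
    ...   | x , x∈D , wx with toggle-members {C = C} x∈D
    ...     | inj₁ refl = ⊥-elim (not-¬ (trans (adj-sym G w u) (∈N⁻ w∈Nu)) wx)
    ...     | inj₂ x∈C  = x , x∈C , wx

  through⇐ : ∀ {S u C} → u ∈ S → MaxCliqueIn (S ∩ N G u) C → MaxCliqueIn S (toggle u C) × u ∈ toggle u C
  through⇐ {S} {u} {C} u∈S (C⊆ , C-clique , C-blocked) = (D⊆S , D-clique , D-blocked) , toggle-∉ u∉C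
    where
    u-adj : ∀ {x} → x ∈ C → adj G u x ≡ true
    u-adj x∈C = ∈N⁻ (proj₂ (x∈p∩q⁻ S (N G u) (C⊆ x∈C)))
    u∉C : u ∉ C
    u∉C u∈C = not-¬ (u-adj u∈C) (irrefl G u)
    D⊆S : toggle u C ⊆ S
    D⊆S x∈D with toggle-members {C = C} x∈D
    ... | inj₁ refl = u∈S
    ... | inj₂ x∈C  = proj₁ (x∈p∩q⁻ S (N G u) (C⊆ x∈C))
    D-clique : IsClique G (toggle u C)
    D-clique = toggle-clique C-clique u∉C u-adj
    D-blocked : ∀ w → w ∈ S → w ∉ toggle u C → ∃[ x ] (x ∈ toggle u C × adj G w x ≡ false)
    D-blocked w w∈S w∉D with w ≟ᶠ u
    ... | yes refl = ⊥-elim (w∉D (toggle-∉ u∉C))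
    ... | no  w≢u with adj G u w in uw
    ...   | false = u , toggle-∉ u∉C , trans (adj-sym G w u) uw
    ...   | true with C-blocked w (x∈p∩q⁺ (w∈S , ∈N⁺ uw)) (w∉D ∘ toggle-≢⁺ w≢u)
    ...     | x , x∈C , wx = x , toggle-≢⁺ (λ { refl → u∉C x∈C }) x∈C , wx

  #through≡#maxCliques∩N : ∀ {S u} → u ∈ S → #maxCliquesThrough S u ≡ #maxCliques (S ∩ N G u)
  #through≡#maxCliques∩N {S} {u} u∈S =
    trans (sym (sumSubsets-toggle n u (λ C → 𝟙 (maxCliqueIn? S C ×-dec (u ∈? C)))))
          (sumSubsets-cong n λ C → 𝟙-cong (maxCliqueIn? S (toggle u C) ×-dec (u ∈? toggle u C))
                                          (maxCliqueIn? (S ∩ N G u) C)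
                                          (λ (D-max , u∈D) → through⇒ D-max u∈D) (through⇐ u∈S))

  Transversal : Subset n → Subset n → Set
  Transversal S T = ∀ {C} → MaxCliqueIn S C → ∃[ u ] (u ∈ T × u ∈ C)

  Independent : Subset n → Set
  Independent T = ∀ {u v} → u ∈ T → v ∈ T → adj G u v ≡ false

  #maxCliques≤sumOver : ∀ {S T} → Transversal S T → #maxCliques S ≤ sumOver T (#maxCliquesThrough S)
  #maxCliques≤sumOver {S} {T} transversal =
    ≤-trans (sumSubsets-mono n λ C → counted C (maxCliqueIn? S C))
            (≤-reflexive (sumSubsets-sumOver n T _))
    where
    counted : ∀ C (C? : Dec (MaxCliqueIn S C)) → 𝟙 C? ≤ sumOver T (λ u → 𝟙 (C? ×-dec (u ∈? C)))
    counted C (no  _)     = z≤n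
    counted C (yes C-max) with transversal C-max
    ... | u , u∈T , u∈C =
      ≤-trans (≤-reflexive (sym (𝟙-yes (yes C-max ×-dec (u ∈? C)) (C-max , u∈C)))) (term≤sumOver _ u∈T)

  -- An independent transversal meets each maximal clique exactly once.
  #maxCliques≡sumOver : ∀ {S T} → Transversal S T → Independent T →
                        #maxCliques S ≡ sumOver T (#maxCliquesThrough S)
  #maxCliques≡sumOver {S} {T} transversal independent =
    trans (sumSubsets-cong n λ C → counted C (maxCliqueIn? S C)) (sumSubsets-sumOver n T _)
    where
    counted : ∀ C (C? : Dec (MaxCliqueIn S C)) → 𝟙 C? ≡ sumOver T (λ u → 𝟙 (C? ×-dec (u ∈? C)))
    counted C (no  ¬C-max) = sym (sumOver-0 T λ {u} _ → 𝟙-no (no ¬C-max ×-dec (u ∈? C)) (¬C-max ∘ proj₁))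
    counted C (yes C-max) with transversal C-max
    ... | u , u∈T , u∈C = sym (trans (sumOver-single _ u∈T others) (𝟙-yes (yes C-max ×-dec (u ∈? C)) (C-max , u∈C)))
      where
      others : ∀ {v} → v ∈ T → v ≢ u → 𝟙 (yes C-max ×-dec (v ∈? C)) ≡ 0
      others {v} v∈T v≢u = 𝟙-no (yes C-max ×-dec (v ∈? C)) λ (_ , v∈C) →
        not-¬ (proj₁ (proj₂ C-max) v u v∈C u∈C v≢u) (independent v∈T u∈T)

  -- Join lemma: if T ⊆ S is a nonempty independent set, completely joined to
  -- S ─ T, whose members all have the same neighbourhood R inside S, then every
  -- maximal clique of G[S] is one vertex of T plus a maximal clique of G[R].
  #maxCliques-join : ∀ {S T R} → Nonempty T → T ⊆ S → Independent T →
                     (∀ {u x} → u ∈ T → x ∈ S → x ∉ T → adj G u x ≡ true) →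
                     (∀ {u} → u ∈ T → S ∩ N G u ≡ R) →
                     #maxCliques S ≡ ∣ T ∣ * #maxCliques R
  #maxCliques-join {S} {T} {R} (t , t∈T) T⊆S independent joined neighbourhood = begin
    #maxCliques S                                  ≡⟨ #maxCliques≡sumOver transversal independent ⟩
    sumOver T (#maxCliquesThrough S)               ≡⟨ sumOver-cong T through-R ⟩
    sumOver T (λ _ → #maxCliques R)                ≡⟨ sumOver-const T (#maxCliques R) ⟩
    ∣ T ∣ * #maxCliques R                          ∎
    where
    open ≡-Reasoning
    through-R : ∀ {u} → u ∈ T → #maxCliquesThrough S u ≡ #maxCliques R
    through-R u∈T = trans (#through≡#maxCliques∩N (T⊆S u∈T)) (cong #maxCliques (neighbourhood u∈T))
    transversal : Transversal S T
    transversal {C} (C⊆S , _ , blocked) with t ∈? C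
    ... | yes t∈C = t , t∈T , t∈C
    ... | no  t∉C with blocked t (T⊆S t∈T) t∉C
    ...   | x , x∈C , tx with x ∈? T
    ...     | yes x∈T = x , x∈T , x∈C
    ...     | no  x∉T = ⊥-elim (not-¬ (joined t∈T (C⊆S x∈C) x∉T) tx)

  -- A maximal clique of G[S] either contains v or is a maximal clique of G[S - v].
  #maxCliques-delete : ∀ S v → #maxCliques S ≤ #maxCliquesThrough S v + #maxCliques (S - v)
  #maxCliques-delete S v = ≤-trans (sumSubsets-mono n counted) (≤-reflexive (sumSubsets-+ n _ _))
    where
    counted : ∀ C → 𝟙 (maxCliqueIn? S C) ≤ 𝟙 (maxCliqueIn? S C ×-dec (v ∈? C)) + 𝟙 (maxCliqueIn? (S - v) C)
    counted C with v ∈? C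
    ... | yes v∈C = ≤-trans (𝟙-mono (maxCliqueIn? S C) (maxCliqueIn? S C ×-dec yes v∈C) (_, v∈C)) (m≤m+n _ _)
    ... | no  v∉C = ≤-trans (𝟙-mono (maxCliqueIn? S C) (maxCliqueIn? (S - v) C) still-maximal) (m≤n+m _ _)
      where
      still-maximal : MaxCliqueIn S C → MaxCliqueIn (S - v) C
      still-maximal (C⊆S , C-clique , blocked) =
        (λ x∈C → x∈p∧x≢y⇒x∈p-y (C⊆S x∈C) λ { refl → v∉C x∈C }) , C-clique ,
        λ w w∈S-v → blocked w (p─q⊆p S ⁅ v ⁆ w∈S-v)

  #maxCliques-empty : ∀ {S} → Empty S → #maxCliques S ≡ 1
  #maxCliques-empty {S} S-empty =
    trans (sumSubsets-cong n λ C → 𝟙-cong (maxCliqueIn? S C) (≡-dec _≟ᵇ_ C ⊥) is-empty empty-is-max)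
          (sumSubsets-≡⊥ n)
    where
    is-empty : ∀ {C} → MaxCliqueIn S C → C ≡ ⊥
    is-empty (C⊆S , _) = Empty-unique λ (x , x∈C) → S-empty (x , C⊆S x∈C)
    empty-is-max : ∀ {C} → C ≡ ⊥ → MaxCliqueIn S C
    empty-is-max refl = ⊥⊆ , (λ _ _ x∈⊥ → ⊥-elim (∉⊥ x∈⊥)) , λ w w∈S → ⊥-elim (S-empty (w , w∈S))

≤-numeral : ∀ a b {a≤b : True (a ≤? b)} → a ≤ b
≤-numeral a b {a≤b} = toWitness a≤b

-- The Moon–Moser function h, which bounds the number of maximal cliques of an
-- m-vertex graph (moonMoserBound below).
moonMoser : ℕ → ℕ
moonMoser 0 = 1
moonMoser 1 = 1
moonMoser 2 = 2
moonMoser 3 = 3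
moonMoser 4 = 4
moonMoser (suc (suc (suc (suc (suc m))))) = 3 * moonMoser (suc (suc m))

moonMoser-pos : ∀ m → 1 ≤ moonMoser m
moonMoser-pos 0 = ≤-refl
moonMoser-pos 1 = ≤-refl
moonMoser-pos 2 = ≤-numeral 1 2
moonMoser-pos 3 = ≤-numeral 1 3
moonMoser-pos 4 = ≤-numeral 1 4
moonMoser-pos (suc (suc (suc (suc (suc m))))) = ≤-trans (moonMoser-pos (suc (suc m))) (m≤m+n _ _)

moonMoser-suc : ∀ m → moonMoser m ≤ moonMoser (suc m)
moonMoser-suc 0 = ≤-numeral 1 1
moonMoser-suc 1 = ≤-numeral 1 2
moonMoser-suc 2 = ≤-numeral 2 3
moonMoser-suc 3 = ≤-numeral 3 4
moonMoser-suc 4 = ≤-numeral 4 6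
moonMoser-suc (suc (suc (suc (suc (suc m))))) = *-monoʳ-≤ 3 (moonMoser-suc (suc (suc m)))

moonMoser-mono : ∀ {m k} → m ≤ k → moonMoser m ≤ moonMoser k
moonMoser-mono {m} m≤k with m≤n⇒∃[o]m+o≡n m≤k
... | o , refl = increase o
  where
  increase : ∀ o → moonMoser m ≤ moonMoser (m + o)
  increase zero    = ≤-reflexive (cong moonMoser (sym (+-identityʳ m)))
  increase (suc o) = ≤-trans (increase o) (≤-trans (moonMoser-suc (m + o)) (≤-reflexive (cong moonMoser (sym (+-suc m o)))))

moonMoser-+3 : ∀ m → 3 * moonMoser m ≤ moonMoser (3 + m)
moonMoser-+3 0 = ≤-numeral 3 3
moonMoser-+3 1 = ≤-numeral 3 4
moonMoser-+3 (suc (suc m)) = ≤-refl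

moonMoser-+2 : ∀ m → 2 * moonMoser m ≤ moonMoser (2 + m)
moonMoser-+2 0 = ≤-numeral 2 2
moonMoser-+2 1 = ≤-numeral 2 3
moonMoser-+2 2 = ≤-numeral 4 4
moonMoser-+2 3 = ≤-numeral 6 6
moonMoser-+2 4 = ≤-numeral 8 9
moonMoser-+2 (suc (suc (suc (suc (suc m))))) = begin
  2 * (3 * moonMoser (2 + m)) ≡⟨ x∙yz≈y∙xz 2 3 (moonMoser (2 + m)) ⟩
  3 * (2 * moonMoser (2 + m)) ≤⟨ *-monoʳ-≤ 3 (moonMoser-+2 (suc (suc m))) ⟩
  3 * moonMoser (4 + m)       ∎
  where open ≤-Reasoning

moonMoser-* : ∀ j m → 1 ≤ j → j * moonMoser m ≤ moonMoser (j + m)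
moonMoser-* 1 m _ = ≤-trans (≤-reflexive (+-identityʳ (moonMoser m))) (moonMoser-suc m)
moonMoser-* 2 m _ = moonMoser-+2 m
moonMoser-* 3 m _ = moonMoser-+3 m
moonMoser-* 4 m _ = begin
  4 * moonMoser m       ≡⟨ *-assoc 2 2 (moonMoser m) ⟩
  2 * (2 * moonMoser m) ≤⟨ *-monoʳ-≤ 2 (moonMoser-+2 m) ⟩
  2 * moonMoser (2 + m) ≤⟨ moonMoser-+2 (2 + m) ⟩
  moonMoser (4 + m)     ∎
  where open ≤-Reasoning
moonMoser-* (suc (suc (suc (suc (suc j))))) m _ = begin
  (5 + j) * moonMoser m         ≤⟨ *-monoˡ-≤ (moonMoser m) 5+j≤3*[2+j] ⟩
  (3 * (2 + j)) * moonMoser m   ≡⟨ *-assoc 3 (2 + j) (moonMoser m) ⟩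
  3 * ((2 + j) * moonMoser m)   ≤⟨ *-monoʳ-≤ 3 (moonMoser-* (suc (suc j)) m (s≤s z≤n)) ⟩
  3 * moonMoser (2 + j + m)     ∎
  where
  open ≤-Reasoning
  5+j≤3*[2+j] : 5 + j ≤ 3 * (2 + j)
  5+j≤3*[2+j] = ≤-trans (+-mono-≤ (≤-numeral 5 6) (m≤n*m j 3)) (≤-reflexive (sym (*-distribˡ-+ 3 2 j)))

moonMoser-3q : ∀ q → moonMoser (q * 3) ≡ 3 ^ q
moonMoser-3q 0             = refl
moonMoser-3q 1             = refl
moonMoser-3q (suc (suc q)) = cong (3 *_) (moonMoser-3q (suc q))

moonMoser-3q+3 : ∀ q → moonMoser (q * 3 + 3) ≡ 3 * moonMoser (q * 3)
moonMoser-3q+3 q = begin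
  moonMoser (q * 3 + 3)    ≡⟨ cong moonMoser (+-comm (q * 3) 3) ⟩
  moonMoser (suc q * 3)    ≡⟨ moonMoser-3q (suc q) ⟩
  3 * 3 ^ q                ≡⟨ cong (3 *_) (moonMoser-3q q) ⟨
  3 * moonMoser (q * 3)    ∎
  where open ≡-Reasoning

module UpperBounds {n : ℕ} (G : Graph n) where
  open MaximalCliques G

  -- For v ∈ S of maximum degree Δ in G[S], the set T of
  -- non-neighbours of v in S (v included) meets every maximal clique, and the
  -- maximal cliques through u ∈ T are those of G[S ∩ N(u)], a graph on at
  -- most Δ vertices; so G[S] has at most |T|·h(Δ) ≤ h(|T| + Δ) = h(|S|).
  moonMoserBound : ∀ S → #maxCliques S ≤ moonMoser ∣ S ∣
  moonMoserBound S = bounded ∣ S ∣ S ≤-refl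
    where
    bounded : ∀ k S → ∣ S ∣ ≤ k → #maxCliques S ≤ moonMoser ∣ S ∣
    bounded k S ∣S∣≤k with nonempty? S
    bounded k S ∣S∣≤k | no S-empty =
      ≤-trans (≤-reflexive (#maxCliques-empty S-empty)) (moonMoser-pos ∣ S ∣)
    bounded zero S ∣S∣≤0 | yes (x , x∈S) with () ← ≤-trans (∈⇒∣S∣>0 x∈S) ∣S∣≤0
    bounded (suc k) S ∣S∣≤1+k | yes S-nonempty with argmax S S-nonempty (λ x → ∣ S ∩ N G x ∣)
    ... | v , v∈S , v-max = begin
      #maxCliques S                     ≤⟨ #maxCliques≤sumOver transversal ⟩
      sumOver T (#maxCliquesThrough S)  ≤⟨ sumOver-mono T through-bound ⟩
      sumOver T (λ _ → moonMoser Δ)     ≡⟨ sumOver-const T (moonMoser Δ) ⟩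
      ∣ T ∣ * moonMoser Δ               ≤⟨ moonMoser-* ∣ T ∣ Δ (∈⇒∣S∣>0 v∈T) ⟩
      moonMoser (∣ T ∣ + Δ)             ≡⟨ cong moonMoser (trans (+-comm ∣ T ∣ Δ) (sym split)) ⟩
      moonMoser ∣ S ∣                   ∎
      where
      open ≤-Reasoning
      Δ : ℕ
      Δ = ∣ S ∩ N G v ∣
      T : Subset n
      T = S ∩ ∁ (N G v)
      split : ∣ S ∣ ≡ Δ + ∣ T ∣
      split = ∣S∣≡∣S∩A∣+∣S∩∁A∣ S (N G v)
      non-neighbour : ∀ {x} → x ∈ S → adj G v x ≡ false → x ∈ T
      non-neighbour x∈S vx = x∈p∩q⁺ (x∈S , x∉p⇒x∈∁p λ x∈Nv → not-¬ (∈N⁻ x∈Nv) vx)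
      v∈T : v ∈ T
      v∈T = non-neighbour v∈S (irrefl G v)
      transversal : Transversal S T
      transversal {C} (C⊆S , _ , blocked) with v ∈? C
      ... | yes v∈C = v , v∈T , v∈C
      ... | no  v∉C with blocked v v∈S v∉C
      ...   | x , x∈C , vx = x , non-neighbour (C⊆S x∈C) vx , x∈C
      Δ<∣S∣ : Δ < ∣ S ∣
      Δ<∣S∣ = ≤-trans (m<m+n Δ (∈⇒∣S∣>0 v∈T)) (≤-reflexive (sym split))
      through-bound : ∀ {u} → u ∈ T → #maxCliquesThrough S u ≤ moonMoser Δ
      through-bound {u} u∈T = begin
        #maxCliquesThrough S u        ≡⟨ #through≡#maxCliques∩N u∈S ⟩
        #maxCliques (S ∩ N G u)       ≤⟨ bounded k (S ∩ N G u) ∣S∩Nu∣≤k ⟩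
        moonMoser ∣ S ∩ N G u ∣       ≤⟨ moonMoser-mono (v-max u∈S) ⟩
        moonMoser Δ                   ∎
        where
        u∈S : u ∈ S
        u∈S = proj₁ (x∈p∩q⁻ S (∁ (N G v)) u∈T)
        ∣S∩Nu∣≤k : ∣ S ∩ N G u ∣ ≤ k
        ∣S∩Nu∣≤k = ≤-pred (≤-trans (s≤s (v-max u∈S)) (≤-trans Δ<∣S∣ ∣S∣≤1+k))

  -- If G is d-degenerate and h(d + 3) ≤ 3·h(d), then G[S]
  -- with |S| ≤ d + 3 + m has at most (3 + m)·h(d) maximal cliques: delete a
  -- vertex v of degree ≤ d in G[S]; the maximal cliques through v are those of
  -- G[S ∩ N(v)], at most h(d) of them, and the others are maximal in G[S - v].
  degenerateBound : ∀ d → Degenerate G d → moonMoser (d + 3) ≤ 3 * moonMoser d →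
                    ∀ m S → ∣ S ∣ ≤ d + 3 + m → #maxCliques S ≤ (3 + m) * moonMoser d
  degenerateBound d degenerate growth zero S ∣S∣≤d+3+0 = begin
    #maxCliques S        ≤⟨ moonMoserBound S ⟩
    moonMoser ∣ S ∣      ≤⟨ moonMoser-mono (≤-trans ∣S∣≤d+3+0 (≤-reflexive (+-identityʳ (d + 3)))) ⟩
    moonMoser (d + 3)    ≤⟨ growth ⟩
    3 * moonMoser d      ∎
    where open ≤-Reasoning
  degenerateBound d degenerate growth (suc m) S ∣S∣≤ with nonempty? S
  ... | no S-empty = begin
    #maxCliques S                    ≡⟨ #maxCliques-empty S-empty ⟩
    1                                ≤⟨ moonMoser-pos d ⟩
    moonMoser d                      ≤⟨ m≤m+n (moonMoser d) _ ⟩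
    (4 + m) * moonMoser d            ∎
    where open ≤-Reasoning
  ... | yes S-nonempty with degenerate S S-nonempty
  ...   | v , v∈S , deg≤d = begin
    #maxCliques S                                       ≤⟨ #maxCliques-delete S v ⟩
    #maxCliquesThrough S v + #maxCliques (S - v)        ≤⟨ +-mono-≤ through-v rest ⟩
    moonMoser d + (3 + m) * moonMoser d                 ∎
    where
    open ≤-Reasoning
    through-v : #maxCliquesThrough S v ≤ moonMoser d
    through-v = begin
      #maxCliquesThrough S v     ≡⟨ #through≡#maxCliques∩N v∈S ⟩
      #maxCliques (S ∩ N G v)    ≤⟨ moonMoserBound (S ∩ N G v) ⟩
      moonMoser ∣ S ∩ N G v ∣    ≤⟨ moonMoser-mono deg≤d ⟩
      moonMoser d                ∎
    rest : #maxCliques (S - v) ≤ (3 + m) * moonMoser d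
    rest = degenerateBound d degenerate growth m (S - v)
             (≤-pred (≤-trans (x∈p⇒∣p-x∣<∣p∣ v∈S) (≤-trans ∣S∣≤ (≤-reflexive (+-suc (d + 3) m)))))

  numMaximalCliques≤ : ∀ d → Degenerate G d → moonMoser (d + 3) ≤ 3 * moonMoser d → d + 3 ≤ n →
                       numMaximalCliques G ≤ (n ∸ d) * moonMoser d
  numMaximalCliques≤ d degenerate growth d+3≤n with m≤n⇒∃[o]m+o≡n d+3≤n
  ... | m , refl = begin
    numMaximalCliques G              ≡⟨ numMaximalCliques≡#maxCliques⊤ ⟩
    #maxCliques ⊤                    ≤⟨ degenerateBound d degenerate growth m ⊤ (≤-reflexive (∣⊤∣≡n _)) ⟩
    (3 + m) * moonMoser d            ≡⟨ cong (_* moonMoser d) n∸d≡3+m ⟨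
    (d + 3 + m ∸ d) * moonMoser d    ∎
    where
    open ≤-Reasoning
    n∸d≡3+m : d + 3 + m ∸ d ≡ 3 + m
    n∸d≡3+m = trans (cong (_∸ d) (+-assoc d 3 m)) (m+n∸m≡n d (3 + m))

minDegree≤degeneracy : ∀ {n} (G : Graph n) {d k} → Fin n → (∀ v → d ≤ degIn G ⊤ v) →
                       Degenerate G k → d ≤ k
minDegree≤degeneracy G x minDegree degenerate with degenerate ⊤ (x , ∈⊤)
... | v , _ , deg≤k = ≤-trans (minDegree v) deg≤k

completeMultipartite : ∀ {n} → (Fin n → ℕ) → Graph n
completeMultipartite c = record
  { adj    = λ u v → not (does (c u ≟ c v))
  ; sym    = λ u v → cong not (does-cong (c u ≟ c v) (c v ≟ c u) sym sym)
  ; irrefl = λ v → cong not (dec-true (c v ≟ c v) refl)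
  }

module CompleteMultipartite {n : ℕ} (c : Fin n → ℕ) where
  G : Graph n
  G = completeMultipartite c
  open MaximalCliques G

  c≢⇒adj : ∀ {u v} → c u ≢ c v → adj G u v ≡ true
  c≢⇒adj {u} {v} cu≢cv = cong not (dec-false (c u ≟ c v) cu≢cv)

  c≡⇒nonadj : ∀ {u v} → c u ≡ c v → adj G u v ≡ false
  c≡⇒nonadj {u} {v} cu≡cv = cong not (dec-true (c u ≟ c v) cu≡cv)

  adj⇒c≢ : ∀ {u v} → adj G u v ≡ true → c u ≢ c v
  adj⇒c≢ uv cu≡cv = not-¬ uv (c≡⇒nonadj cu≡cv)

  part : ℕ → Subset n
  part k = subset λ x → c x ≟ k

  from : ℕ → Subset n
  from k = subset λ x → k ≤? c x

  #maxCliques-peel : ∀ k → Nonempty (part k) → #maxCliques (from k) ≡ ∣ part k ∣ * #maxCliques (from (suc k))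
  #maxCliques-peel k part-nonempty =
    #maxCliques-join part-nonempty part⊆from independent joined neighbourhood
    where
    class : ∀ {x} → x ∈ part k → c x ≡ k
    class = ∈subset⁻ (λ x → c x ≟ k)
    part⊆from : part k ⊆ from k
    part⊆from x∈ = ∈subset⁺ (λ x → k ≤? c x) (≤-reflexive (sym (class x∈)))
    independent : Independent (part k)
    independent u∈ v∈ = c≡⇒nonadj (trans (class u∈) (sym (class v∈)))
    joined : ∀ {u x} → u ∈ part k → x ∈ from k → x ∉ part k → adj G u x ≡ true
    joined u∈ _ x∉ = c≢⇒adj λ cu≡cx → x∉ (∈subset⁺ (λ x → c x ≟ k) (trans (sym cu≡cx) (class u∈)))
    neighbourhood : ∀ {u} → u ∈ part k → from k ∩ N G u ≡ from (suc k)
    neighbourhood {u} u∈ = ⊆-antisym higher lower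
      where
      higher : from k ∩ N G u ⊆ from (suc k)
      higher x∈ with x∈p∩q⁻ (from k) (N G u) x∈
      ... | x∈from , x∈N = ∈subset⁺ (λ x → suc k ≤? c x)
        (≤∧≢⇒< (∈subset⁻ (λ x → k ≤? c x) x∈from) λ k≡cx → adj⇒c≢ (∈N⁻ x∈N) (trans (class u∈) k≡cx))
      lower : from (suc k) ⊆ from k ∩ N G u
      lower x∈ with ∈subset⁻ (λ x → suc k ≤? c x) x∈
      ... | k<cx = x∈p∩q⁺ ( ∈subset⁺ (λ x → k ≤? c x) (<⇒≤ k<cx)
                          , ∈N⁺ (c≢⇒adj λ cu≡cx → <-irrefl (trans (sym (class u∈)) cu≡cx) k<cx))

  #maxCliques-beyond : ∀ k → (∀ x → c x < k) → #maxCliques (from k) ≡ 1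
  #maxCliques-beyond k below = #maxCliques-empty λ (x , x∈) → <⇒≱ (below x) (∈subset⁻ (λ x → k ≤? c x) x∈)

  degree : ∀ u → degIn G ⊤ u ≡ n ∸ ∣ part (c u) ∣
  degree u = trans (cong ∣_∣ (⊆-antisym outside-part inside-N)) (∣∁p∣≡n∸∣p∣ (part (c u)))
    where
    outside-part : ⊤ ∩ N G u ⊆ ∁ (part (c u))
    outside-part x∈ = x∉p⇒x∈∁p λ x∈part →
      adj⇒c≢ (∈N⁻ (proj₂ (x∈p∩q⁻ ⊤ (N G u) x∈))) (sym (∈subset⁻ (λ x → c x ≟ c u) x∈part))
    inside-N : ∁ (part (c u)) ⊆ ⊤ ∩ N G u
    inside-N x∈ = x∈p∩q⁺ (∈⊤ , ∈N⁺ (c≢⇒adj λ cu≡cx →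
      x∈∁p⇒x∉p x∈ (∈subset⁺ (λ x → c x ≟ c u) (sym cu≡cx))))

  -- If all parts are numbered at most K, the graph is d-degenerate as soon as
  -- the parts below K have at most d vertices in total: a vertex of a highest
  -- part present in S has all its neighbours in S in lower parts.
  degenerate : ∀ K d → (∀ x → c x ≤ K) → ∣ subset (λ x → c x <? K) ∣ ≤ d → Degenerate G d
  degenerate K d ≤K ∣below∣≤d S S-nonempty with argmax S S-nonempty c
  ... | v , v∈S , v-highest = v , v∈S , ≤-trans (p⊆q⇒∣p∣≤∣q∣ neighbours-below) ∣below∣≤d
    where
    neighbours-below : S ∩ N G v ⊆ subset (λ x → c x <? K)
    neighbours-below x∈ with x∈p∩q⁻ S (N G v) x∈
    ... | x∈S , x∈N = ∈subset⁺ (λ x → c x <? K)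
      (<-≤-trans (≤∧≢⇒< (v-highest x∈S) λ cx≡cv → adj⇒c≢ (∈N⁻ x∈N) (sym cx≡cv)) (≤K v))

-- The extremal graph for degeneracy d = 3q on n ≥ d + 3 vertices: the complete
-- multipartite graph with parts {3k, 3k+1, 3k+2} numbered k < q and one part
-- {d, …, n - 1} numbered q.
module Extremal (q n : ℕ) (d+3≤n : q * 3 + 3 ≤ n) where
  d : ℕ
  d = q * 3

  classℕ : ℕ → ℕ
  classℕ x with x <? d
  ... | yes _ = x / 3
  ... | no  _ = q

  class : Fin n → ℕ
  class x = classℕ (toℕ x)

  open CompleteMultipartite class public
  open MaximalCliques G

  classℕ-low : ∀ {x} → x < d → classℕ x ≡ x / 3
  classℕ-low {x} x<d with x <? d
  ... | yes _   = refl
  ... | no  x≮d = ⊥-elim (x≮d x<d)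

  classℕ-high : ∀ {x} → d ≤ x → classℕ x ≡ q
  classℕ-high {x} d≤x with x <? d
  ... | yes x<d = ⊥-elim (≤⇒≯ d≤x x<d)
  ... | no  _   = refl

  classℕ<q⇒<d : ∀ {x} → classℕ x < q → x < d
  classℕ<q⇒<d {x} cx<q with x <? d
  ... | yes x<d = x<d
  ... | no  _   = ⊥-elim (<-irrefl refl cx<q)

  <d⇒classℕ<q : ∀ {x} → x < d → classℕ x < q
  <d⇒classℕ<q x<d = subst (_< q) (sym (classℕ-low x<d)) (m<n*o⇒m/o<n x<d)

  classℕ≤q : ∀ x → classℕ x ≤ q
  classℕ≤q x with x <? d
  ... | yes x<d = <⇒≤ (m<n*o⇒m/o<n x<d)
  ... | no  _   = ≤-refl

  classℕ≡k⇒segment : ∀ {k x} → k < q → classℕ x ≡ k → k * 3 ≤ x × x < suc k * 3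
  classℕ≡k⇒segment {k} {x} k<q cx≡k = lower , upper
    where
    x/3≡k : x / 3 ≡ k
    x/3≡k = trans (sym (classℕ-low (classℕ<q⇒<d (subst (_< q) (sym cx≡k) k<q)))) cx≡k
    lower : k * 3 ≤ x
    lower = subst (λ z → z * 3 ≤ x) x/3≡k (m/n*n≤m x 3)
    upper : x < suc k * 3
    upper = subst (λ z → x < suc z * 3) x/3≡k
      (subst (_< suc (x / 3) * 3) (sym (m≡m%n+[m/n]*n x 3)) (+-monoˡ-< (x / 3 * 3) (m%n<n x 3)))

  segment⇒classℕ≡k : ∀ {k x} → k < q → k * 3 ≤ x → x < suc k * 3 → classℕ x ≡ k
  segment⇒classℕ≡k {k} {x} k<q 3k≤x x<3k+3 = trans (classℕ-low x<d) (≤-antisym x/3≤k k≤x/3)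
    where
    x<d : x < d
    x<d = <-≤-trans x<3k+3 (*-monoˡ-≤ 3 k<q)
    x/3≤k : x / 3 ≤ k
    x/3≤k = ≤-pred (m<n*o⇒m/o<n x<3k+3)
    k≤x/3 : k ≤ x / 3
    k≤x/3 = subst (_≤ x / 3) (m*n/n≡m k 3) (/-monoˡ-≤ 3 3k≤x)

  d≤n : d ≤ n
  d≤n = m+n≤o⇒m≤o d d+3≤n

  ∣below-q∣ : ∣ subset (λ x → class x <? q) ∣ ≡ d
  ∣below-q∣ = trans (cong ∣_∣ (⊆-antisym
      (λ x∈ → ∈subset⁺ (λ x → toℕ x <? d) (classℕ<q⇒<d (∈subset⁻ (λ x → class x <? q) x∈)))
      (λ x∈ → ∈subset⁺ (λ x → class x <? q) (<d⇒classℕ<q (∈subset⁻ (λ x → toℕ x <? d) x∈)))))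
    (∣initial∣ d d≤n)

  ∣part-k∣ : ∀ {k} → k < q → ∣ part k ∣ ≡ 3
  ∣part-k∣ {k} k<q = begin
    ∣ part k ∣                        ≡⟨ cong ∣_∣ (⊆-antisym part⊆segment segment⊆part) ⟩
    ∣ segment {n} (k * 3) (suc k * 3) ∣ ≡⟨ ∣segment∣ (k * 3) (suc k * 3) (m≤n+m (k * 3) 3) 3k+3≤n ⟩
    suc k * 3 ∸ k * 3                 ≡⟨ m+n∸n≡m 3 (k * 3) ⟩
    3                                 ∎
    where
    open ≡-Reasoning
    3k+3≤n : suc k * 3 ≤ n
    3k+3≤n = ≤-trans (*-monoˡ-≤ 3 k<q) d≤n
    part⊆segment : part k ⊆ segment (k * 3) (suc k * 3)
    part⊆segment {x} x∈ with classℕ≡k⇒segment k<q (∈subset⁻ (λ x → class x ≟ k) x∈)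
    ... | 3k≤x , x<3k+3 = x∈p∩q⁺ ( ∈subset⁺ (λ x → toℕ x <? suc k * 3) x<3k+3
                                 , x∉p⇒x∈∁p λ x∈I → ≤⇒≯ 3k≤x (∈subset⁻ (λ x → toℕ x <? k * 3) x∈I))
    segment⊆part : segment (k * 3) (suc k * 3) ⊆ part k
    segment⊆part {x} x∈ with x∈p∩q⁻ (initial (suc k * 3)) (∁ (initial (k * 3))) x∈
    ... | x∈I , x∈∁I = ∈subset⁺ (λ x → class x ≟ k) (segment⇒classℕ≡k k<q
      (≮⇒≥ λ x<3k → x∈∁p⇒x∉p x∈∁I (∈subset⁺ (λ x → toℕ x <? k * 3) x<3k))
      (∈subset⁻ (λ x → toℕ x <? suc k * 3) x∈I))

  ∣part-q∣ : ∣ part q ∣ ≡ n ∸ d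
  ∣part-q∣ = begin
    ∣ part q ∣             ≡⟨ cong ∣_∣ (⊆-antisym part⊆∁initial ∁initial⊆part) ⟩
    ∣ ∁ (initial {n} d) ∣  ≡⟨ ∣∁p∣≡n∸∣p∣ (initial {n} d) ⟩
    n ∸ ∣ initial {n} d ∣  ≡⟨ cong (n ∸_) (∣initial∣ d d≤n) ⟩
    n ∸ d                  ∎
    where
    open ≡-Reasoning
    part⊆∁initial : part q ⊆ ∁ (initial d)
    part⊆∁initial x∈ = x∉p⇒x∈∁p λ x∈I → <-irrefl (∈subset⁻ (λ x → class x ≟ q) x∈)
      (<d⇒classℕ<q (∈subset⁻ (λ x → toℕ x <? d) x∈I))
    ∁initial⊆part : ∁ (initial d) ⊆ part q
    ∁initial⊆part x∈ = ∈subset⁺ (λ x → class x ≟ q)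
      (classℕ-high (≮⇒≥ λ x<d → x∈∁p⇒x∉p x∈ (∈subset⁺ (λ x → toℕ x <? d) x<d)))

  3≤n∸d : 3 ≤ n ∸ d
  3≤n∸d = ≤-trans (≤-reflexive (sym (m+n∸m≡n d 3))) (∸-monoˡ-≤ d d+3≤n)

  -- Every part has at most n - d vertices, so every vertex has degree at least d.
  ∣part∣≤n∸d : ∀ x → ∣ part (class x) ∣ ≤ n ∸ d
  ∣part∣≤n∸d x with m≤n⇒m<n∨m≡n (classℕ≤q (toℕ x))
  ... | inj₁ cx<q = ≤-trans (≤-reflexive (∣part-k∣ cx<q)) 3≤n∸d
  ... | inj₂ cx≡q = ≤-reflexive (trans (cong (∣_∣ ∘ part) cx≡q) ∣part-q∣)

  hasDegeneracy : HasDegeneracy G d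
  hasDegeneracy = degenerate q d (classℕ≤q ∘ toℕ) (≤-reflexive ∣below-q∣)
                , λ _ → minDegree≤degeneracy G (fromℕ< 0<n) minDegree
    where
    0<n : 0 < n
    0<n = ≤-trans (s≤s z≤n) (m+n≤o⇒n≤o d d+3≤n)
    minDegree : ∀ v → d ≤ degIn G ⊤ v
    minDegree v = begin
      d                           ≡⟨ m∸[m∸n]≡n d≤n ⟨
      n ∸ (n ∸ d)                 ≤⟨ ∸-monoʳ-≤ n (∣part∣≤n∸d v) ⟩
      n ∸ ∣ part (class v) ∣      ≡⟨ degree v ⟨
      degIn G ⊤ v                 ∎
      where open ≤-Reasoning

  #maxCliques-from-q : #maxCliques (from q) ≡ n ∸ d
  #maxCliques-from-q = begin
    #maxCliques (from q)                     ≡⟨ #maxCliques-peel q (∣S∣>0⇒nonempty (part q) 0<∣part-q∣) ⟩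
    ∣ part q ∣ * #maxCliques (from (suc q))  ≡⟨ cong₂ _*_ ∣part-q∣ (#maxCliques-beyond (suc q) (s≤s ∘ classℕ≤q ∘ toℕ)) ⟩
    (n ∸ d) * 1                              ≡⟨ *-identityʳ (n ∸ d) ⟩
    n ∸ d                                    ∎
    where
    open ≡-Reasoning
    0<∣part-q∣ : 0 < ∣ part q ∣
    0<∣part-q∣ = ≤-trans (s≤s z≤n) (≤-trans 3≤n∸d (≤-reflexive (sym ∣part-q∣)))

  #maxCliques-from : ∀ j k → k + j ≡ q → #maxCliques (from k) ≡ 3 ^ j * (n ∸ d)
  #maxCliques-from zero k k+0≡q = begin
    #maxCliques (from k)    ≡⟨ cong (#maxCliques ∘ from) (trans (sym (+-identityʳ k)) k+0≡q) ⟩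
    #maxCliques (from q)    ≡⟨ #maxCliques-from-q ⟩
    n ∸ d                   ≡⟨ *-identityˡ (n ∸ d) ⟨
    1 * (n ∸ d)             ∎
    where open ≡-Reasoning
  #maxCliques-from (suc j) k k+1+j≡q = begin
    #maxCliques (from k)                     ≡⟨ #maxCliques-peel k (∣S∣>0⇒nonempty (part k) 0<∣part-k∣) ⟩
    ∣ part k ∣ * #maxCliques (from (suc k))  ≡⟨ cong₂ _*_ (∣part-k∣ k<q) (#maxCliques-from j (suc k) (trans (sym (+-suc k j)) k+1+j≡q)) ⟩
    3 * (3 ^ j * (n ∸ d))                    ≡⟨ *-assoc 3 (3 ^ j) (n ∸ d) ⟨
    3 ^ suc j * (n ∸ d)                      ∎
    where
    open ≡-Reasoning
    k<q : k < q
    k<q = <-≤-trans (m<m+n k (s≤s z≤n)) (≤-reflexive k+1+j≡q)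
    0<∣part-k∣ : 0 < ∣ part k ∣
    0<∣part-k∣ = ≤-trans (s≤s z≤n) (≤-reflexive (sym (∣part-k∣ k<q)))

  numMaximalCliques-extremal : numMaximalCliques G ≡ (n ∸ d) * 3 ^ q
  numMaximalCliques-extremal = begin
    numMaximalCliques G        ≡⟨ numMaximalCliques≡#maxCliques⊤ ⟩
    #maxCliques ⊤              ≡⟨ cong #maxCliques ⊤≡from-0 ⟩
    #maxCliques (from 0)       ≡⟨ #maxCliques-from q 0 refl ⟩
    3 ^ q * (n ∸ d)            ≡⟨ *-comm (3 ^ q) (n ∸ d) ⟩
    (n ∸ d) * 3 ^ q            ∎
    where
    open ≡-Reasoning
    ⊤≡from-0 : ⊤ ≡ from 0
    ⊤≡from-0 = ⊆-antisym (λ _ → ∈subset⁺ (λ x → 0 ≤? class x) z≤n) (λ _ → ∈⊤)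

mainTheorem3 : ∀ (d n : ℕ) → 3 ∣ d → d + 3 ≤ n →
    (∀ (G : Graph n) → HasDegeneracy G d → numMaximalCliques G ≤ (n ∸ d) * 3 ^ (d / 3))
    × (Σ[ G ∈ Graph n ] (HasDegeneracy G d × numMaximalCliques G ≡ (n ∸ d) * 3 ^ (d / 3)))
mainTheorem3 d n (divides q refl) d+3≤n rewrite m*n/n≡m q 3 ⦃ _ ⦄ = upper , lower
  where
  upper : ∀ (G : Graph n) → HasDegeneracy G d → numMaximalCliques G ≤ (n ∸ d) * 3 ^ q
  upper G (degenerate , _) = subst (λ z → numMaximalCliques G ≤ (n ∸ d) * z) (moonMoser-3q q)
    (UpperBounds.numMaximalCliques≤ G d degenerate (≤-reflexive (moonMoser-3q+3 q)) d+3≤n)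
  lower : Σ[ G ∈ Graph n ] (HasDegeneracy G d × numMaximalCliques G ≡ (n ∸ d) * 3 ^ q)
  lower = Extremal.G q n d+3≤n , Extremal.hasDegeneracy q n d+3≤n , Extremal.numMaximalCliques-extremal q n d+3≤n
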